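{- Let $p$ be a prime and let $A$ be a finite permutation group whose order is a power of $p$. If $A$ has a regular abelian subgroup $G$ of index $p$, and $G$ has a subgroup $M$ of index $p$ that is normalised but not centralised by a point-stabiliser in $A$, then $A$ has a regular nonabelian subgroup.
   Context: A subgroup of a permutation group is regular if it acts regularly (transitively with trivial point stabilisers) on the underlying set. -}

module Defs where

open import Data.Nat using (ℕ; _*_; _^_)
open import Data.Nat.Primality using (Prime)
open import Data.Fin using (Fin)
open import Data.Fin.Permutation using (Permutation′; _⟨$⟩ʳ_; _≈_; id; flip; _∘ₚ_)
open import Data.Product using (Σ; ∃; ∃-syntax; _×_; _,_)
open import Relation.Nullary using (¬_)
open import Relation.Binary.PropositionalEquality using (_≡_)
open import Level using (Level; suc; zero)

Perm : ℕ → Set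
Perm n = Permutation′ n

PermSet : ℕ → Set₁
PermSet n = Perm n → Set

module _ {n : ℕ} where

  _⊆_ : PermSet n → PermSet n → Set
  S ⊆ T = ∀ g → S g → T g

  record IsSubgroup (S : PermSet n) : Set where
    field
      resp  : ∀ {g h} → g ≈ h → S g → S h
      id∈   : S id
      ∘∈    : ∀ {g h} → S g → S h → S (g ∘ₚ h)
      inv∈  : ∀ {g} → S g → S (flip g)

  record HasOrder (S : PermSet n) (k : ℕ) : Set where
    field
      enum  : Fin k → Perm n
      enum∈ : ∀ i → S (enum i)
      inj   : ∀ i j → enum i ≈ enum j → i ≡ j
      surj  : ∀ g → S g → ∃[ i ] (enum i ≈ g)

  IsPGroup : ℕ → PermSet n → Set
  IsPGroup p S = ∃[ e ] HasOrder S (p ^ e)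

  HasIndex : PermSet n → PermSet n → ℕ → Set
  HasIndex H S p = ∃[ k ] (HasOrder H k × HasOrder S (p * k))

  IsRegular : PermSet n → Set
  IsRegular S =
    (∀ x y → ∃[ g ] (S g × g ⟨$⟩ʳ x ≡ y)) ×
    (∀ g x → S g → g ⟨$⟩ʳ x ≡ x → g ≈ id)

  IsAbelian : PermSet n → Set
  IsAbelian S = ∀ g h → S g → S h → (g ∘ₚ h) ≈ (h ∘ₚ g)

  Stab : PermSet n → Fin n → PermSet n
  Stab A x a = A a × (a ⟨$⟩ʳ x ≡ x)

  Normalises : PermSet n → PermSet n → Set
  Normalises T M = ∀ a m → T a → M m → M (flip a ∘ₚ (m ∘ₚ a))

  Centralises : PermSet n → PermSet n → Set
  Centralises T M = ∀ a m → T a → M m → (a ∘ₚ m) ≈ (m ∘ₚ a)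

module Submission where

-- Pick a in the stabiliser Aₓ and m₀ in M with a m₀ ≠ m₀ a. The centraliser of M in A lies between
-- G and A, where |A : G| = p is prime, and misses a, so it is G; hence Aₓ, which normalises M, also
-- normalises G. Counting cosets, a has order p modulo G, so a ^ p = 1 as G ∩ Aₓ = 1, and some
-- g ∈ G has order p modulo M. Since |G : M| = p, conjugation by a, an element of order p, fixes
-- every coset of M in G. Then t = a g satisfies t ^ k ≡ g ^ k a ^ k modulo M, so R = M⟨t⟩ has order
-- p |M| = |G| = n, is normalised by G and meets Aₓ trivially; a subgroup normalised by a transitive
-- group and meeting a point stabiliser trivially is semiregular, so R is regular. It is nonabelian
-- because t and m₀ do not commute.

open import Level using (Level; _⊔_; 0ℓ)
open import Data.Nat as ℕ using (ℕ; zero; suc; _+_; _*_; _∸_; z≤n; s≤s; NonZero)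
import Data.Nat.Properties as ℕ
open import Data.Fin as Fin using (Fin; zero; suc; toℕ; fromℕ<; punchOut; combine; remQuot)
import Data.Fin.Properties as Fin
open import Data.Product using (∃-syntax; _×_; _,_; proj₁; proj₂; uncurry)
open import Data.Sum using (_⊎_; inj₁; inj₂)
open import Function using (_∘_; id)
open import Relation.Nullary using (¬_; yes; no; contradiction)
open import Relation.Nullary.Decidable using (map′; ¬?; _→-dec_; _×-dec_; decidable-stable)
open import Relation.Unary using (Pred; Decidable)
open import Relation.Binary using (_Respects_; tri<; tri≈; tri>) renaming (Decidable to Decidable₂)
open import Algebra.Bundles using (Group)
open import Algebra.Structures using (IsGroup)
open import Tactic.MonoidSolver using (solve)
import Relation.Binary.Reasoning.Setoid as ≈-Reasoning
open import Relation.Binary.PropositionalEquality as ≡ using (_≡_; _≢_; module ≡-Reasoning)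
open import Data.Nat.DivMod using (m≡m%n+[m/n]*n; m%n<n)
open import Data.Nat.Divisibility using (_∣_; divides; *-cancelʳ-∣)
open _∣_ using (quotient; equality)
open import Data.Nat.Primality using (Prime; prime⇒irreducible; prime⇒nonTrivial)

private
  variable
    ℓ₁ ℓ₂ : Level

-- Counting in finite sets

least : ∀ {k} {P : Pred (Fin k) ℓ₁} → Decidable P → ∀ {i} → P i →
        ∃[ j ] (P j × ∀ {l} → l Fin.< j → ¬ P l)
least {k = suc k} {P = P} P? {i} Pi with P? zero | i
... | yes P0 | _      = zero , P0 , λ ()
... | no ¬P0 | zero   = contradiction Pi ¬P0
... | no ¬P0 | suc i′ with least (P? ∘ suc) Pi
...   | j , Pj , below = suc j , Pj , below′
  where
  below′ : ∀ {l} → l Fin.< suc j → ¬ P l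
  below′ {zero}  _         = ¬P0
  below′ {suc l} (s≤s l<j) = below l<j

record Enumeration {N : ℕ} (P : Pred (Fin N) ℓ₁) : Set ℓ₁ where
  field
    size           : ℕ
    elem           : Fin size → Fin N
    elem∈          : ∀ i → P (elem i)
    elem-injective : ∀ {i j} → elem i ≡ elem j → i ≡ j
    position       : ∀ {j} → P j → Fin size
    elem-position  : ∀ {j} (Pj : P j) → elem (position Pj) ≡ j

enumerate : ∀ {N} {P : Pred (Fin N) ℓ₁} → Decidable P → Enumeration P
enumerate {N = zero} P? = record
  { size = 0 ; elem = λ () ; elem∈ = λ () ; elem-injective = λ { {()} }
  ; position = λ { {()} } ; elem-position = λ { {()} } }
enumerate {N = suc N} {P = P} P? with enumerate (P? ∘ suc) | P? zero
... | E | yes P0 = record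
  { size = suc size ; elem = elem′ ; elem∈ = elem∈′ ; elem-injective = inj
  ; position = pos ; elem-position = elem-pos }
  where
  open Enumeration E
  elem′ : Fin (suc size) → Fin (suc N)
  elem′ zero    = zero
  elem′ (suc i) = suc (elem i)
  elem∈′ : ∀ i → P (elem′ i)
  elem∈′ zero    = P0
  elem∈′ (suc i) = elem∈ i
  inj : ∀ {i j} → elem′ i ≡ elem′ j → i ≡ j
  inj {zero}  {zero}  _ = ≡.refl
  inj {suc i} {suc j} e = ≡.cong suc (elem-injective (Fin.suc-injective e))
  pos : ∀ {j} → P j → Fin (suc size)
  pos {zero}  _  = zero
  pos {suc j} Pj = suc (position Pj)
  elem-pos : ∀ {j} (Pj : P j) → elem′ (pos Pj) ≡ j
  elem-pos {zero}  _  = ≡.refl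
  elem-pos {suc j} Pj = ≡.cong suc (elem-position Pj)
... | E | no ¬P0 = record
  { size = size ; elem = suc ∘ elem ; elem∈ = elem∈
  ; elem-injective = elem-injective ∘ Fin.suc-injective
  ; position = pos ; elem-position = elem-pos }
  where
  open Enumeration E
  pos : ∀ {j} → P j → Fin size
  pos {zero}  P0 = contradiction P0 ¬P0
  pos {suc j} Pj = position Pj
  elem-pos : ∀ {j} (Pj : P j) → suc (elem (pos Pj)) ≡ j
  elem-pos {zero}  P0 = contradiction P0 ¬P0
  elem-pos {suc j} Pj = ≡.cong suc (elem-position Pj)

injective⇒surjective : ∀ {m k} {f : Fin m → Fin k} → (∀ {i j} → f i ≡ f j → i ≡ j) →
                       k ℕ.≤ m → ∀ j → ∃[ i ] f i ≡ j
injective⇒surjective {m = m} {k = suc k} {f} f-inj k≤m j with Fin.any? (λ i → f i Fin.≟ j)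
... | yes hit = hit
... | no miss = contradiction (Fin.injective⇒≤ avoid-inj) (ℕ.<⇒≱ k≤m)
  where
  avoid : Fin m → Fin k
  avoid i = punchOut (λ fi≡j → miss (i , ≡.sym fi≡j))
  avoid-inj : ∀ {i i′} → avoid i ≡ avoid i′ → i ≡ i′
  avoid-inj {i} {i′} e = f-inj (Fin.punchOut-injective {i = j}
    (λ fi≡j → miss (i , ≡.sym fi≡j)) (λ fi′≡j → miss (i′ , ≡.sym fi′≡j)) e)

remQuot-injective : ∀ {q k} {i j : Fin (q * k)} → remQuot {q} k i ≡ remQuot k j → i ≡ j
remQuot-injective {q = q} {k = k} {i} {j} e = begin
  i                                ≡⟨ Fin.combine-remQuot {q} k i ⟨
  uncurry combine (remQuot {q} k i) ≡⟨ ≡.cong (uncurry combine) e ⟩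
  uncurry combine (remQuot {q} k j) ≡⟨ Fin.combine-remQuot {q} k j ⟩
  j                                ∎
  where open ≡-Reasoning

least-positive : {P : Pred ℕ ℓ₁} → Decidable P → ∀ {w} → 0 ℕ.< w → P w →
                 ∃[ e ] (0 ℕ.< e × P e × ∀ {i} → 0 ℕ.< i → i ℕ.< e → ¬ P i)
least-positive {P = P} P? {suc w} _ Pw
  with least (P? ∘ suc ∘ toℕ) (≡.subst (P ∘ suc) (≡.sym (Fin.toℕ-fromℕ w)) Pw)
... | j , Pj , below = suc (toℕ j) , s≤s z≤n , Pj , excluded
  where
  excluded : ∀ {i} → 0 ℕ.< i → i ℕ.< suc (toℕ j) → ¬ P i
  excluded {suc i} _ (s≤s i<j) = ≡.subst (¬_ ∘ P ∘ suc) (Fin.toℕ-fromℕ< i<1+w)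
    (below {fromℕ< i<1+w} (≡.subst (ℕ._< toℕ j) (≡.sym (Fin.toℕ-fromℕ< i<1+w)) i<j))
    where
    i<1+w : i ℕ.< suc w
    i<1+w = ℕ.<-trans i<j (Fin.toℕ<n j)

prime-period-is-least : ∀ {p} {P : Pred ℕ ℓ₁} → Prime p → Decidable P →
  (∀ {i j} → P i → P j → P (i + j)) → (∀ {i j} → P i → P (i + j) → P j) →
  P p → ¬ P 1 → ∀ {i} → 0 ℕ.< i → i ℕ.< p → ¬ P i
prime-period-is-least {p = p} {P} p-prime P? +-closed ∸-closed Pp ¬P1 {i} 0<i i<p Pi
  with least-positive P? 0<i Pi
... | f , 0<f , Pf , below = f≢p (f∣p⇒f≡p f∣p)
  where
  instance
    _ : NonZero f
    _ = ℕ.>-nonZero 0<f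
  P0 : P 0
  P0 = ∸-closed Pf (≡.subst P (≡.sym (ℕ.+-identityʳ f)) Pf)
  multiples : ∀ q → P (q * f)
  multiples zero    = P0
  multiples (suc q) = +-closed Pf (multiples q)
  P[p%f] : P (p ℕ.% f)
  P[p%f] = ∸-closed (multiples (p ℕ./ f))
    (≡.subst P (≡.trans (m≡m%n+[m/n]*n p f) (ℕ.+-comm (p ℕ.% f) _)) Pp)
  p%f≡0 : p ℕ.% f ≡ 0
  p%f≡0 with p ℕ.% f in eq
  ... | zero  = ≡.refl
  ... | suc r = contradiction (≡.subst P eq P[p%f])
                  (below (s≤s z≤n) (≡.subst (ℕ._< f) eq (m%n<n p f)))
  f∣p : f ∣ p
  f∣p = divides (p ℕ./ f) (≡.trans (m≡m%n+[m/n]*n p f) (≡.cong (ℕ._+ p ℕ./ f * f) p%f≡0))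
  f∣p⇒f≡p : f ∣ p → f ≡ p
  f∣p⇒f≡p f∣p with prime⇒irreducible p-prime f∣p
  ... | inj₁ ≡.refl = contradiction Pf ¬P1
  ... | inj₂ f≡p  = f≡p
  f≢p : f ≢ p
  f≢p ≡.refl = ℕ.<-irrefl ≡.refl (ℕ.≤-<-trans (ℕ.≮⇒≥ λ i<f → below 0<i i<f Pi) i<p)

-- Finite groups

module FiniteGroupTheory {c ℓ} (𝔾 : Group c ℓ) (_≟_ : Decidable₂ (Group._≈_ 𝔾)) where

  open Group 𝔾
  open import Algebra.Properties.Group 𝔾
  import Algebra.Properties.Monoid.Mult monoid as Mult
  open import Relation.Binary.Reasoning.Setoid setoid
  open import Relation.Unary using (_⊆_)

  private
    variable
      h k l q s : ℕ
      a x y z u : Carrier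
      G H K L M S T : Pred Carrier _

  //-cancel : ∀ x y z → (x // y) ∙ (y // z) ≈ x // z
  //-cancel x y z = begin
    (x ∙ y ⁻¹) ∙ (y ∙ z ⁻¹)  ≈⟨ assoc x (y ⁻¹) (y ∙ z ⁻¹) ⟩
    x ∙ (y ⁻¹ ∙ (y ∙ z ⁻¹))  ≈⟨ ∙-congˡ (\\-leftDividesʳ y (z ⁻¹)) ⟩
    x ∙ z ⁻¹                 ∎

  x∙u≈y∙v⇒u//v≈x\\y : ∀ {x y u v} → x ∙ u ≈ y ∙ v → u // v ≈ x \\ y
  x∙u≈y∙v⇒u//v≈x\\y {x} {y} {u} {v} eq = begin
    u ∙ v ⁻¹                ≈⟨ ∙-congʳ (\\-leftDividesʳ x u) ⟨
    (x ⁻¹ ∙ (x ∙ u)) ∙ v ⁻¹  ≈⟨ ∙-congʳ (∙-congˡ eq) ⟩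
    (x ⁻¹ ∙ (y ∙ v)) ∙ v ⁻¹  ≈⟨ ∙-congʳ (assoc (x ⁻¹) y v) ⟨
    ((x ⁻¹ ∙ y) ∙ v) ∙ v ⁻¹  ≈⟨ //-rightDividesʳ v (x ⁻¹ ∙ y) ⟩
    x ⁻¹ ∙ y                ∎

  ⁻¹-comm : x ∙ y ≈ y ∙ x → x ⁻¹ ∙ y ≈ y ∙ x ⁻¹
  ⁻¹-comm {x} {y} comm = begin
    x ⁻¹ ∙ y                  ≈⟨ //-rightDividesʳ x (x ⁻¹ ∙ y) ⟨
    x ⁻¹ ∙ y ∙ x ∙ x ⁻¹       ≈⟨ ∙-congʳ (assoc (x ⁻¹) y x) ⟩
    x ⁻¹ ∙ (y ∙ x) ∙ x ⁻¹     ≈⟨ ∙-congʳ (∙-congˡ comm) ⟨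
    x ⁻¹ ∙ (x ∙ y) ∙ x ⁻¹     ≈⟨ ∙-congʳ (\\-leftDividesʳ x y) ⟩
    y ∙ x ⁻¹                  ∎

  infixr 8 _^_
  _^_ : Carrier → ℕ → Carrier
  x ^ k = k Mult.× x

  ^-//-^ : ∀ x d i → x ^ (d + i) // x ^ i ≈ x ^ d
  ^-//-^ x d i = trans (∙-congʳ (Mult.×-homo-+ x d i)) (//-rightDividesʳ (x ^ i) (x ^ d))

  conj : Carrier → Carrier → Carrier
  conj a x = a ∙ x ∙ a ⁻¹

  conj-∙ : ∀ a x → conj a x ∙ a ≈ a ∙ x
  conj-∙ a x = //-rightDividesˡ a (a ∙ x)

  conj-cong : ∀ a → x ≈ y → conj a x ≈ conj a y
  conj-cong a x≈y = ∙-congʳ (∙-congˡ x≈y)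

  conj-congˡ : ∀ {a b} x → a ≈ b → conj a x ≈ conj b x
  conj-congˡ x a≈b = ∙-cong (∙-congʳ a≈b) (⁻¹-cong a≈b)

  ε-conj : ∀ x → conj ε x ≈ x
  ε-conj x = trans (∙-cong (identityˡ x) ε⁻¹≈ε) (identityʳ x)

  conj-ε : ∀ a → conj a ε ≈ ε
  conj-ε a = trans (∙-congʳ (identityʳ a)) (inverseʳ a)

  conj-homo : ∀ a x y → conj a (x ∙ y) ≈ conj a x ∙ conj a y
  conj-homo a x y = begin
    a ∙ (x ∙ y) ∙ a ⁻¹                 ≈⟨ ∙-congʳ (∙-congˡ (∙-congʳ (//-rightDividesˡ a x))) ⟨
    a ∙ ((x ∙ a ⁻¹) ∙ a ∙ y) ∙ a ⁻¹     ≈⟨ solve monoid ⟩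
    (a ∙ x ∙ a ⁻¹) ∙ (a ∙ y ∙ a ⁻¹)     ∎

  conj-comp : ∀ a b x → conj (a ∙ b) x ≈ conj a (conj b x)
  conj-comp a b x = begin
    a ∙ b ∙ x ∙ (a ∙ b) ⁻¹       ≈⟨ ∙-congˡ (⁻¹-anti-homo-∙ a b) ⟩
    a ∙ b ∙ x ∙ (b ⁻¹ ∙ a ⁻¹)    ≈⟨ solve monoid ⟩
    a ∙ (b ∙ x ∙ b ⁻¹) ∙ a ⁻¹    ∎

  conj-⁻¹ : ∀ a x → conj a (x ⁻¹) ≈ (conj a x) ⁻¹
  conj-⁻¹ a x = sym (begin
    (a ∙ x ∙ a ⁻¹) ⁻¹          ≈⟨ ⁻¹-anti-homo-∙ (a ∙ x) (a ⁻¹) ⟩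
    a ⁻¹ ⁻¹ ∙ (a ∙ x) ⁻¹       ≈⟨ ∙-cong (⁻¹-involutive a) (⁻¹-anti-homo-∙ a x) ⟩
    a ∙ (x ⁻¹ ∙ a ⁻¹)          ≈⟨ assoc a (x ⁻¹) (a ⁻¹) ⟨
    a ∙ x ⁻¹ ∙ a ⁻¹            ∎)

  conj-// : ∀ a x y → conj a (x // y) ≈ conj a x // conj a y
  conj-// a x y = trans (conj-homo a x (y ⁻¹)) (∙-congˡ (conj-⁻¹ a y))

  conj-inverse : ∀ a x → conj (a ⁻¹) (conj a x) ≈ x
  conj-inverse a x = begin
    conj (a ⁻¹) (conj a x)   ≈⟨ conj-comp (a ⁻¹) a x ⟨
    conj (a ⁻¹ ∙ a) x        ≈⟨ conj-congˡ x (inverseˡ a) ⟩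
    conj ε x                 ≈⟨ ε-conj x ⟩
    x                        ∎

  comm⇒conj≈ : x ∙ y ≈ y ∙ x → conj x y ≈ y
  comm⇒conj≈ {x} {y} comm = trans (∙-congʳ comm) (//-rightDividesʳ x y)

  conj-^ : ∀ a x k → conj a (x ^ k) ≈ conj a x ^ k
  conj-^ a x zero    = conj-ε a
  conj-^ a x (suc k) = trans (conj-homo a x (x ^ k)) (∙-congˡ (conj-^ a x k))

  ∙-//-∙ : ∀ x y z → (x ∙ y) // (x ∙ z) ≈ conj x (y // z)
  ∙-//-∙ x y z = begin
    (x ∙ y) ∙ (x ∙ z) ⁻¹       ≈⟨ ∙-congˡ (⁻¹-anti-homo-∙ x z) ⟩
    (x ∙ y) ∙ (z ⁻¹ ∙ x ⁻¹)    ≈⟨ solve monoid ⟩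
    x ∙ (y ∙ z ⁻¹) ∙ x ⁻¹      ∎

  ⁅_,_⁆ : Carrier → Carrier → Carrier
  ⁅ x , y ⁆ = x ∙ y ∙ x ⁻¹ ∙ y ⁻¹

  ⁅⁆-⁻¹ : ∀ x y → ⁅ x , y ⁆ ⁻¹ ≈ ⁅ y , x ⁆
  ⁅⁆-⁻¹ x y = begin
    (x ∙ y ∙ x ⁻¹ ∙ y ⁻¹) ⁻¹           ≈⟨ ⁻¹-anti-homo-∙ (x ∙ y ∙ x ⁻¹) (y ⁻¹) ⟩
    y ⁻¹ ⁻¹ ∙ (x ∙ y ∙ x ⁻¹) ⁻¹        ≈⟨ ∙-cong (⁻¹-involutive y) (⁻¹-anti-homo-∙ (x ∙ y) (x ⁻¹)) ⟩
    y ∙ (x ⁻¹ ⁻¹ ∙ (x ∙ y) ⁻¹)         ≈⟨ ∙-congˡ (∙-cong (⁻¹-involutive x) (⁻¹-anti-homo-∙ x y)) ⟩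
    y ∙ (x ∙ (y ⁻¹ ∙ x ⁻¹))            ≈⟨ solve monoid ⟩
    y ∙ x ∙ y ⁻¹ ∙ x ⁻¹                ∎

  conj-∙-commuting : ∀ {w g} a → w ∙ g ≈ g ∙ w → conj w (a ∙ g) ≈ ⁅ w , a ⁆ ∙ (a ∙ g)
  conj-∙-commuting {w} {g} a comm = sym (begin
    w ∙ a ∙ w ⁻¹ ∙ a ⁻¹ ∙ (a ∙ g)      ≈⟨ solve monoid ⟩
    w ∙ a ∙ w ⁻¹ ∙ (a ⁻¹ ∙ a) ∙ g      ≈⟨ ∙-congʳ (∙-congˡ (inverseˡ a)) ⟩
    w ∙ a ∙ w ⁻¹ ∙ ε ∙ g               ≈⟨ solve monoid ⟩
    w ∙ a ∙ (w ⁻¹ ∙ g)                 ≈⟨ ∙-congˡ (⁻¹-comm comm) ⟩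
    w ∙ a ∙ (g ∙ w ⁻¹)                 ≈⟨ solve monoid ⟩
    w ∙ (a ∙ g) ∙ w ⁻¹                 ∎)

  ∙-∙-conj : ∀ a g h b → (a ∙ g) ∙ (h ∙ b) ≈ conj a (g ∙ h) ∙ (a ∙ b)
  ∙-∙-conj a g h b = begin
    (a ∙ g) ∙ (h ∙ b)           ≈⟨ solve monoid ⟩
    a ∙ (g ∙ h) ∙ b             ≈⟨ ∙-congʳ (conj-∙ a (g ∙ h)) ⟨
    conj a (g ∙ h) ∙ a ∙ b      ≈⟨ assoc _ a b ⟩
    conj a (g ∙ h) ∙ (a ∙ b)    ∎

  record IsSubgroup (H : Pred Carrier ℓ₁) : Set (c ⊔ ℓ ⊔ ℓ₁) where
    field
      resp : H Respects _≈_
      ε∈   : H ε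
      ∙∈   : H x → H y → H (x ∙ y)
      ⁻¹∈  : H x → H (x ⁻¹)

    ^∈ : H x → ∀ k → H (x ^ k)
    ^∈ x∈ zero    = ε∈
    ^∈ x∈ (suc k) = ∙∈ x∈ (^∈ x∈ k)

    //∈ : H x → H y → H (x // y)
    //∈ x∈ y∈ = ∙∈ x∈ (⁻¹∈ y∈)

    //-refl : H (x // x)
    //-refl {x} = resp (sym (inverseʳ x)) ε∈

    //-sym : H (x // y) → H (y // x)
    //-sym {x} {y} = resp (⁻¹-anti-homo-// x y) ∘ ⁻¹∈

    //-trans : H (x // y) → H (y // z) → H (x // z)
    //-trans {x} {y} {z} xy yz = resp (//-cancel x y z) (∙∈ xy yz)

  record HasOrder (H : Pred Carrier ℓ₁) (k : ℕ) : Set (c ⊔ ℓ ⊔ ℓ₁) where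
    field
      enum           : Fin k → Carrier
      enum∈          : ∀ i → H (enum i)
      enum-injective : ∀ {i j} → enum i ≈ enum j → i ≡ j
      index          : H x → Fin k
      enum-index     : (x∈ : H x) → enum (index x∈) ≈ x

    index-injective : (x∈ : H x) (y∈ : H y) → index x∈ ≡ index y∈ → x ≈ y
    index-injective {x} {y} x∈ y∈ eq = begin
      x                ≈⟨ enum-index x∈ ⟨
      enum (index x∈)  ≡⟨ ≡.cong enum eq ⟩
      enum (index y∈)  ≈⟨ enum-index y∈ ⟩
      y                ∎

    decidable : H Respects _≈_ → Decidable H
    decidable resp x = map′ (λ (i , e) → resp e (enum∈ i)) (λ x∈ → index x∈ , enum-index x∈)
                            (Fin.any? (λ i → enum i ≟ x))

  order-mono : H ⊆ K → HasOrder H h → HasOrder K k → h ℕ.≤ k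
  order-mono H⊆K Hₒ Kₒ =
    Fin.injective⇒≤ {f = K.index ∘ H⊆K ∘ H.enum∈} (H.enum-injective ∘ K.index-injective _ _)
    where
    module H = HasOrder Hₒ
    module K = HasOrder Kₒ

  order-unique : HasOrder H h → HasOrder H k → h ≡ k
  order-unique Hₒ Hₒ′ = ℕ.≤-antisym (order-mono id Hₒ Hₒ′) (order-mono id Hₒ′ Hₒ)

  order-nonZero : IsSubgroup H → HasOrder H k → NonZero k
  order-nonZero {k = suc _} _ _ = _
  order-nonZero {k = zero} H-sub Hₒ =
    contradiction (HasOrder.index Hₒ (IsSubgroup.ε∈ H-sub)) Fin.¬Fin0

  equal-order⇒⊇ : H Respects _≈_ → H ⊆ K → HasOrder H k → HasOrder K k → K ⊆ H
  equal-order⇒⊇ resp H⊆K Hₒ Kₒ x∈K =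
    resp (K.index-injective _ x∈K (proj₂ preimage)) (H.enum∈ (proj₁ preimage))
    where
    module H = HasOrder Hₒ
    module K = HasOrder Kₒ
    preimage : ∃[ i ] K.index (H⊆K (H.enum∈ i)) ≡ K.index x∈K
    preimage = injective⇒surjective {f = K.index ∘ H⊆K ∘ H.enum∈}
                 (H.enum-injective ∘ K.index-injective _ _) ℕ.≤-refl (K.index x∈K)

  suborder : HasOrder K k → T Respects _≈_ → T ⊆ K → Decidable T → ∃[ t ] HasOrder T t
  suborder {T = T} Kₒ resp T⊆K T? = size , record
    { enum           = K.enum ∘ elem
    ; enum∈          = elem∈
    ; enum-injective = elem-injective ∘ K.enum-injective
    ; index          = position ∘ index∈
    ; enum-index     = λ x∈ → trans (reflexive (≡.cong K.enum (elem-position (index∈ x∈))))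
                                    (K.enum-index (T⊆K x∈)) }
    where
    module K = HasOrder Kₒ
    open Enumeration (enumerate (T? ∘ K.enum))
    index∈ : (x∈ : T x) → T (K.enum (K.index (T⊆K x∈)))
    index∈ x∈ = resp (sym (K.enum-index (T⊆K x∈))) x∈

  larger⇒∃∉ : H Respects _≈_ → Decidable H → HasOrder H h → HasOrder K k → h ℕ.< k →
              ∃[ x ] (K x × ¬ H x)
  larger⇒∃∉ {H = H} {K = K} resp H? Hₒ Kₒ h<k with Fin.any? (λ i → ¬? (H? (K.enum i)))
    where module K = HasOrder Kₒ
  ... | yes (i , ∉H) = _ , HasOrder.enum∈ Kₒ i , ∉H
  ... | no  none     = contradiction (order-mono K⊆H Kₒ Hₒ) (ℕ.<⇒≱ h<k)
    where
    open HasOrder Kₒ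
    K⊆H : K ⊆ H
    K⊆H x∈ with H? (enum (index x∈))
    ... | yes ∈H = resp (enum-index x∈) ∈H
    ... | no  ∉H = contradiction (index x∈ , ∉H) none

  period : IsSubgroup K → HasOrder K k → K x → ∃[ e ] (0 ℕ.< e × x ^ e ≈ ε)
  period {x = x} K-sub Kₒ x∈ with Fin.pigeonhole (ℕ.n<1+n _) (index ∘ K.^∈ x∈ ∘ toℕ)
    where
    module K = IsSubgroup K-sub
    open HasOrder Kₒ
  ... | i , j , i<j , eq = toℕ j ∸ toℕ i , ℕ.m<n⇒0<n∸m i<j , ∙-cancelˡ (x ^ toℕ i) _ _ x^i∙x^d≈x^i∙ε
    where
    x^i∙x^d≈x^i∙ε : x ^ toℕ i ∙ x ^ (toℕ j ∸ toℕ i) ≈ x ^ toℕ i ∙ ε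
    x^i∙x^d≈x^i∙ε = begin
      x ^ toℕ i ∙ x ^ (toℕ j ∸ toℕ i)  ≈⟨ Mult.×-homo-+ x (toℕ i) _ ⟨
      x ^ (toℕ i + (toℕ j ∸ toℕ i))    ≡⟨ ≡.cong (x ^_) (ℕ.m+[n∸m]≡n (ℕ.<⇒≤ i<j)) ⟩
      x ^ toℕ j                        ≈⟨ HasOrder.index-injective Kₒ _ _ eq ⟨
      x ^ toℕ i                        ≈⟨ identityʳ _ ⟨
      x ^ toℕ i ∙ ε                    ∎

  submonoid⇒subgroup : IsSubgroup K → HasOrder K k → T ⊆ K → T Respects _≈_ → T ε →
                       (∀ {x y} → T x → T y → T (x ∙ y)) → IsSubgroup T
  submonoid⇒subgroup {T = T} K-sub Kₒ T⊆K resp ε∈ ∙∈ = record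
    { resp = resp ; ε∈ = ε∈ ; ∙∈ = ∙∈ ; ⁻¹∈ = ⁻¹∈ }
    where
    ^∈ : T x → ∀ k → T (x ^ k)
    ^∈ x∈ zero    = ε∈
    ^∈ x∈ (suc k) = ∙∈ x∈ (^∈ x∈ k)
    ⁻¹∈ : T x → T (x ⁻¹)
    ⁻¹∈ {x} x∈ with period K-sub Kₒ (T⊆K x∈)
    ... | suc e , _ , x^[1+e]≈ε = resp (inverseʳ-unique x (x ^ e) x^[1+e]≈ε) (^∈ x∈ e)

  noncommuting-pair : HasOrder T k → HasOrder M l → ¬ (∀ {a m} → T a → M m → a ∙ m ≈ m ∙ a) →
                      ∃[ a ] ∃[ m ] (T a × M m × ¬ a ∙ m ≈ m ∙ a)
  noncommuting-pair {T = T} {M = M} Tₒ Mₒ ¬comm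
    with Fin.any? (λ i → Fin.any? (λ j → ¬? ((T.enum i ∙ M.enum j) ≟ (M.enum j ∙ T.enum i))))
    where
    module T = HasOrder Tₒ
    module M = HasOrder Mₒ
  ... | yes (i , j , ¬ij) = _ , _ , HasOrder.enum∈ Tₒ i , HasOrder.enum∈ Mₒ j , ¬ij
  ... | no none = contradiction (λ {a} {m} → comm {a} {m}) ¬comm
    where
    module T = HasOrder Tₒ
    module M = HasOrder Mₒ
    comm : ∀ {a m} → T a → M m → a ∙ m ≈ m ∙ a
    comm {a} {m} a∈ m∈ = begin
      a ∙ m    ≈⟨ ∙-cong (T.enum-index a∈) (M.enum-index m∈) ⟨
      a′ ∙ m′  ≈⟨ decidable-stable ((a′ ∙ m′) ≟ (m′ ∙ a′))
                    (λ ¬eq → none (T.index a∈ , M.index m∈ , ¬eq)) ⟩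
      m′ ∙ a′  ≈⟨ ∙-cong (M.enum-index m∈) (T.enum-index a∈) ⟩
      m ∙ a    ∎
      where
      a′ m′ : Carrier
      a′ = T.enum (T.index a∈)
      m′ = M.enum (M.index m∈)

  record Transversal (H : Pred Carrier ℓ₁) (K : Pred Carrier ℓ₂) (q : ℕ) : Set (c ⊔ ℓ ⊔ ℓ₁ ⊔ ℓ₂) where
    field
      rep       : Fin q → Carrier
      rep∈      : ∀ i → K (rep i)
      separated : ∀ {i j} → H (rep i // rep j) → i ≡ j
      coset     : K x → Fin q
      ∈coset    : (x∈ : K x) → H (x // rep (coset x∈))

  module _ (H-sub : IsSubgroup H) where
    open IsSubgroup H-sub

    same-coset : (Hᵀ : Transversal H K q) (x∈ : K x) (y∈ : K y) →
                 Transversal.coset Hᵀ x∈ ≡ Transversal.coset Hᵀ y∈ → H (x // y)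
    same-coset Hᵀ x∈ y∈ eq = //-trans (∈coset x∈)
      (//-sym (≡.subst (λ i → H (_ // rep i)) (≡.sym eq) (∈coset y∈)))
      where open Transversal Hᵀ

    cosets-pigeonhole : Transversal H K q → (x : Fin (suc q) → Carrier) → (∀ i → K (x i)) →
                        ∃[ i ] ∃[ j ] (i Fin.< j × H (x i // x j))
    cosets-pigeonhole Hᵀ x x∈ with Fin.pigeonhole (ℕ.n<1+n _) (Transversal.coset Hᵀ ∘ x∈)
    ... | i , j , i<j , eq = i , j , i<j , same-coset Hᵀ (x∈ i) (x∈ j) eq

    transversal⇒order : IsSubgroup K → H ⊆ K → Transversal H K q → HasOrder H h →
                        HasOrder K (q * h)
    transversal⇒order {K = K} {q = q} {h = h} K-sub H⊆K Hᵀ Hₒ = record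
      { enum           = pair ∘ remQuot h
      ; enum∈          = pair∈ ∘ remQuot h
      ; enum-injective = remQuot-injective ∘ pair-injective
      ; index          = λ x∈ → combine (coset x∈) (H.index (∈coset x∈))
      ; enum-index     = λ x∈ → trans (reflexive (≡.cong pair (Fin.remQuot-combine _ _)))
          (trans (∙-congʳ (H.enum-index (∈coset x∈))) (//-rightDividesˡ (rep (coset x∈)) _)) }
      where
      open Transversal Hᵀ
      module H = HasOrder Hₒ
      pair : Fin q × Fin h → Carrier
      pair (i , l) = H.enum l ∙ rep i
      pair∈ : ∀ il → K (pair il)
      pair∈ (i , l) = IsSubgroup.∙∈ K-sub (H⊆K (H.enum∈ l)) (rep∈ i)
      pair-injective : ∀ {il jm} → pair il ≈ pair jm → il ≡ jm
      pair-injective {i , l} {j , m} eq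
        with ≡.refl ← separated (resp (sym (x∙u≈y∙v⇒u//v≈x\\y eq))
                                      (∙∈ (⁻¹∈ (H.enum∈ l)) (H.enum∈ m)))
        = ≡.cong (i ,_) (H.enum-injective (∙-cancelʳ (rep i) _ _ eq))

    transversal : H ⊆ K → HasOrder H h → HasOrder K k → ∃[ q ] Transversal H K q
    transversal {K = K} {k = k} H⊆K Hₒ Kₒ = size , record
      { rep = K.enum ∘ elem ; rep∈ = K.enum∈ ∘ elem ; separated = separated
      ; coset = position ∘ canonical ; ∈coset = ∈coset }
      where
      module K = HasOrder Kₒ
      H? : Decidable H
      H? = HasOrder.decidable Hₒ resp
      Canonical : Pred (Fin k) _
      Canonical j = ∀ i → i Fin.< j → ¬ H (K.enum i // K.enum j)
      canonical? : Decidable Canonical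
      canonical? j = Fin.all? (λ i → (i Fin.<? j) →-dec ¬? (H? (K.enum i // K.enum j)))
      open Enumeration (enumerate canonical?)
      separated : ∀ {i j} → H (K.enum (elem i) // K.enum (elem j)) → i ≡ j
      separated {i} {j} r with Fin.<-cmp (elem i) (elem j)
      ... | tri< i<j _ _ = contradiction r (elem∈ j (elem i) i<j)
      ... | tri≈ _ eq _  = elem-injective eq
      ... | tri> _ _ j<i = contradiction (//-sym r) (elem∈ i (elem j) j<i)
      least-in-class : K x → ∃[ j ] (H (K.enum j // x) × Canonical j)
      least-in-class x∈ with least (λ i → H? (K.enum i // K.enum (K.index x∈))) //-refl
      ... | j , j~x , below = j , resp (∙-congˡ (⁻¹-cong (K.enum-index x∈))) j~x
                                , λ i i<j i~j → below i<j (//-trans i~j j~x)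
      canonical : (x∈ : K x) → Canonical (proj₁ (least-in-class x∈))
      canonical = proj₂ ∘ proj₂ ∘ least-in-class
      ∈coset : (x∈ : K x) → H (x // K.enum (elem (position (canonical x∈))))
      ∈coset x∈ rewrite elem-position (canonical x∈) = //-sym (proj₁ (proj₂ (least-in-class x∈)))

    lagrange : IsSubgroup K → H ⊆ K → HasOrder H h → HasOrder K k → h ∣ k
    lagrange K-sub H⊆K Hₒ Kₒ with transversal H⊆K Hₒ Kₒ
    ... | q , Hᵀ = divides q (order-unique Kₒ (transversal⇒order K-sub H⊆K Hᵀ Hₒ))

  prime-index-maximal : ∀ {p} → Prime p → IsSubgroup H → IsSubgroup L → IsSubgroup K →
                        H ⊆ L → L ⊆ K → Decidable L → HasOrder H h → HasOrder K (p * h) →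
                        L ⊆ H ⊎ K ⊆ L
  prime-index-maximal {H = H} {L = L} {K = K} {h = h} {p}
                      p-prime H-sub L-sub K-sub H⊆L L⊆K L? Hₒ Kₒ =
    by-index (prime⇒irreducible p-prime d∣p)
    where
    instance
      _ : NonZero h
      _ = order-nonZero H-sub Hₒ
    Lₒ : HasOrder L (proj₁ (suborder Kₒ (IsSubgroup.resp L-sub) L⊆K L?))
    Lₒ = proj₂ (suborder Kₒ (IsSubgroup.resp L-sub) L⊆K L?)
    h∣l : h ∣ _
    h∣l = lagrange H-sub L-sub H⊆L Hₒ Lₒ
    d : ℕ
    d = quotient h∣l
    order-of-L : ∀ {m} → d * h ≡ m → HasOrder L m
    order-of-L eq = ≡.subst (HasOrder L) (≡.trans (equality h∣l) eq) Lₒ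
    d∣p : d ∣ p
    d∣p = *-cancelʳ-∣ h (lagrange L-sub K-sub L⊆K (order-of-L ≡.refl) Kₒ)
    by-index : d ≡ 1 ⊎ d ≡ p → L ⊆ H ⊎ K ⊆ L
    by-index (inj₁ d≡1) = inj₁ (equal-order⇒⊇ (IsSubgroup.resp H-sub) H⊆L Hₒ
                                  (order-of-L (≡.trans (≡.cong (_* h) d≡1) (ℕ.*-identityˡ h))))
    by-index (inj₂ d≡p) = inj₂ (equal-order⇒⊇ (IsSubgroup.resp L-sub) L⊆K
                                  (order-of-L (≡.cong (_* h) d≡p)) Kₒ)

  NormalisedBy : Pred Carrier ℓ₁ → Carrier → Set (c ⊔ ℓ₁)
  NormalisedBy S a = ∀ {x} → S x → S (conj a x)

  normalisedBy-^ : S Respects _≈_ → NormalisedBy S a → ∀ i → NormalisedBy S (a ^ i)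
  normalisedBy-^ resp S▷a zero    x∈ = resp (sym (ε-conj _)) x∈
  normalisedBy-^ resp S▷a (suc i) x∈ =
    resp (sym (conj-comp _ _ _)) (S▷a (normalisedBy-^ resp S▷a i x∈))

  Centraliser : Pred Carrier ℓ₁ → Pred Carrier ℓ₂ → Pred Carrier (c ⊔ ℓ ⊔ ℓ₁ ⊔ ℓ₂)
  Centraliser K M x = K x × (∀ {m} → M m → x ∙ m ≈ m ∙ x)

  module _ (K-sub : IsSubgroup K) where
    private
      module K = IsSubgroup K-sub

    centraliser-isSubgroup : IsSubgroup (Centraliser K M)
    centraliser-isSubgroup = record
      { resp = λ x≈y (x∈ , comm) → K.resp x≈y x∈ , λ m∈ →
                 trans (∙-congʳ (sym x≈y)) (trans (comm m∈) (∙-congˡ x≈y))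
      ; ε∈   = K.ε∈ , λ {m} _ → trans (identityˡ m) (sym (identityʳ m))
      ; ∙∈   = λ {x} {y} (x∈ , x-comm) (y∈ , y-comm) → K.∙∈ x∈ y∈ , λ {m} m∈ → begin
                 x ∙ y ∙ m     ≈⟨ assoc x y m ⟩
                 x ∙ (y ∙ m)   ≈⟨ ∙-congˡ (y-comm m∈) ⟩
                 x ∙ (m ∙ y)   ≈⟨ assoc x m y ⟨
                 x ∙ m ∙ y     ≈⟨ ∙-congʳ (x-comm m∈) ⟩
                 m ∙ x ∙ y     ≈⟨ assoc m x y ⟩
                 m ∙ (x ∙ y)   ∎
      ; ⁻¹∈  = λ (x∈ , comm) → K.⁻¹∈ x∈ , ⁻¹-comm ∘ comm }

    centraliser? : Decidable K → M Respects _≈_ → HasOrder M l → Decidable (Centraliser K M)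
    centraliser? K? M-resp Mₒ x = K? x ×-dec map′
      (λ comm {m} m∈ → trans (∙-congˡ (sym (enum-index m∈)))
                              (trans (comm (index m∈)) (∙-congʳ (enum-index m∈))))
      (λ comm i → comm (enum∈ i))
      (Fin.all? (λ i → (x ∙ enum i) ≟ (enum i ∙ x)))
      where open HasOrder Mₒ

    centraliser-normalisedBy : K a → NormalisedBy M (a ⁻¹) → NormalisedBy (Centraliser K M) a
    centraliser-normalisedBy {a = a} a∈ M▷a⁻¹ {x} (x∈ , comm) =
      K.∙∈ (K.∙∈ a∈ x∈) (K.⁻¹∈ a∈) , λ {m} m∈ → begin
        conj a x ∙ m                        ≈⟨ ∙-congˡ (m≈ m) ⟩
        conj a x ∙ conj a (conj (a ⁻¹) m)   ≈⟨ conj-homo a x _ ⟨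
        conj a (x ∙ conj (a ⁻¹) m)          ≈⟨ conj-cong a (comm (M▷a⁻¹ m∈)) ⟩
        conj a (conj (a ⁻¹) m ∙ x)          ≈⟨ conj-homo a _ x ⟩
        conj a (conj (a ⁻¹) m) ∙ conj a x   ≈⟨ ∙-congʳ (m≈ m) ⟨
        m ∙ conj a x                        ∎
      where
      m≈ : ∀ m → m ≈ conj a (conj (a ⁻¹) m)
      m≈ m = sym (trans (conj-congˡ _ (sym (⁻¹-involutive a))) (conj-inverse (a ⁻¹) m))

  _·⟨_⟩ : Pred Carrier ℓ₁ → Carrier → Pred Carrier (c ⊔ ℓ ⊔ ℓ₁)
  (S ·⟨ u ⟩) x = ∃[ m ] ∃[ i ] (S m × x ≈ m ∙ u ^ i)

  module CyclicExtension (S-sub : IsSubgroup S) (K-sub : IsSubgroup K) (Kₒ : HasOrder K k)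
                         (S⊆K : S ⊆ K) (u∈K : K u) (S▷u : NormalisedBy S u) where
    private
      module S = IsSubgroup S-sub
      module K = IsSubgroup K-sub

    ⊆·⟨⟩ : S ⊆ S ·⟨ u ⟩
    ⊆·⟨⟩ {x} x∈ = x , 0 , x∈ , sym (identityʳ x)

    ·⟨⟩⊆ : S ·⟨ u ⟩ ⊆ K
    ·⟨⟩⊆ (m , i , m∈ , eq) = K.resp (sym eq) (K.∙∈ (S⊆K m∈) (K.^∈ u∈K i))

    ·⟨⟩-isSubgroup : IsSubgroup (S ·⟨ u ⟩)
    ·⟨⟩-isSubgroup = submonoid⇒subgroup K-sub Kₒ ·⟨⟩⊆
      (λ x≈y (m , i , m∈ , eq) → m , i , m∈ , trans (sym x≈y) eq)
      (⊆·⟨⟩ S.ε∈) ∙∈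
      where
      ∙∈ : ∀ {x y} → (S ·⟨ u ⟩) x → (S ·⟨ u ⟩) y → (S ·⟨ u ⟩) (x ∙ y)
      ∙∈ {x} {y} (m , i , m∈ , x≈) (m′ , j , m′∈ , y≈) =
        m ∙ conj (u ^ i) m′ , i + j , S.∙∈ m∈ (normalisedBy-^ S.resp S▷u i m′∈) , (begin
          x ∙ y                                 ≈⟨ ∙-cong x≈ y≈ ⟩
          m ∙ u ^ i ∙ (m′ ∙ u ^ j)              ≈⟨ solve monoid ⟩
          m ∙ (u ^ i ∙ m′) ∙ u ^ j              ≈⟨ ∙-congʳ (∙-congˡ (conj-∙ (u ^ i) m′)) ⟨
          m ∙ (conj (u ^ i) m′ ∙ u ^ i) ∙ u ^ j  ≈⟨ solve monoid ⟩
          m ∙ conj (u ^ i) m′ ∙ (u ^ i ∙ u ^ j)  ≈⟨ ∙-congˡ (Mult.×-homo-+ u i j) ⟨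
          m ∙ conj (u ^ i) m′ ∙ u ^ (i + j)      ∎)

    module _ {e} (0<e : 0 ℕ.< e) (u^e∈S : S (u ^ e))
             (u^i∉S : ∀ {i} → 0 ℕ.< i → i ℕ.< e → ¬ S (u ^ i)) where

      powers-transversal : Transversal S (S ·⟨ u ⟩) e
      powers-transversal = record
        { rep = λ i → u ^ toℕ i
        ; rep∈ = λ i → ε , toℕ i , S.ε∈ , sym (identityˡ _)
        ; separated = separated
        ; coset = coset
        ; ∈coset = ∈coset }
        where
        instance
          _ : NonZero e
          _ = ℕ.>-nonZero 0<e
        lower-power∉S : ∀ {i j} → i Fin.< j → ¬ S (u ^ toℕ j // u ^ toℕ i)
        lower-power∉S {i} {j} i<j u^j//u^i∈S = u^i∉S (ℕ.m<n⇒0<n∸m i<j)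
          (ℕ.≤-<-trans (ℕ.m∸n≤m (toℕ j) (toℕ i)) (Fin.toℕ<n j))
          (S.resp (^-//-^ u (toℕ j ∸ toℕ i) (toℕ i)) (≡.subst (λ d → S (u ^ d // u ^ toℕ i))
            (≡.sym (ℕ.m∸n+n≡m (ℕ.<⇒≤ i<j))) u^j//u^i∈S))
        separated : ∀ {i j} → S (u ^ toℕ i // u ^ toℕ j) → i ≡ j
        separated {i} {j} ij∈ with Fin.<-cmp i j
        ... | tri< i<j _ _ = contradiction (S.//-sym ij∈) (lower-power∉S i<j)
        ... | tri≈ _ eq _  = eq
        ... | tri> _ _ j<i = contradiction ij∈ (lower-power∉S j<i)
        coset : ∀ {x} → (S ·⟨ u ⟩) x → Fin e
        coset (_ , i , _ , _) = fromℕ< (m%n<n i e)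
        ∈coset : ∀ {x} (x∈ : (S ·⟨ u ⟩) x) → S (x // u ^ toℕ (coset x∈))
        ∈coset {x} (m , i , m∈ , x≈) rewrite Fin.toℕ-fromℕ< (m%n<n i e) =
          S.resp (sym x//u^r≈m∙u^de)
            (S.∙∈ m∈ (S.resp (Mult.×-assocˡ u (i ℕ./ e) e) (S.^∈ u^e∈S (i ℕ./ e))))
          where
          d r : ℕ
          d = i ℕ./ e
          r = i ℕ.% e
          x//u^r≈m∙u^de : x // u ^ r ≈ m ∙ u ^ (d * e)
          x//u^r≈m∙u^de = begin
            x // u ^ r                    ≈⟨ ∙-congʳ x≈ ⟩
            m ∙ u ^ i // u ^ r            ≡⟨ ≡.cong (λ j → m ∙ u ^ j // u ^ r)
                                               (≡.trans (m≡m%n+[m/n]*n i e) (ℕ.+-comm r (d * e))) ⟩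
            m ∙ u ^ (d * e + r) // u ^ r  ≈⟨ assoc m _ _ ⟩
            m ∙ (u ^ (d * e + r) // u ^ r) ≈⟨ ∙-congˡ (^-//-^ u (d * e) r) ⟩
            m ∙ u ^ (d * e)               ∎

      ·⟨⟩-order : HasOrder S s → HasOrder (S ·⟨ u ⟩) (e * s)
      ·⟨⟩-order = transversal⇒order S-sub ·⟨⟩-isSubgroup ⊆·⟨⟩ powers-transversal

  prime-index-power : ∀ {p} → Prime p → IsSubgroup S → IsSubgroup K → S ⊆ K → HasOrder S s →
                      HasOrder K (p * s) → K u → NormalisedBy S u → ¬ S u →
                      S (u ^ p) × (∀ {i} → 0 ℕ.< i → i ℕ.< p → ¬ S (u ^ i))
  prime-index-power {S = S} {s = s} {u = u} {p} p-prime S-sub K-sub S⊆K Sₒ Kₒ u∈K S▷u u∉S =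
    by-index (prime⇒irreducible p-prime e∣p)
    where
    module S = IsSubgroup S-sub
    instance
      _ : NonZero s
      _ = order-nonZero S-sub Sₒ
    period-of-u : ∃[ P ] (0 ℕ.< P × u ^ P ≈ ε)
    period-of-u = period K-sub Kₒ u∈K
    minimal-power : ∃[ e ] (0 ℕ.< e × S (u ^ e) × ∀ {i} → 0 ℕ.< i → i ℕ.< e → ¬ S (u ^ i))
    minimal-power = least-positive (λ i → HasOrder.decidable Sₒ S.resp (u ^ i))
      (proj₁ (proj₂ period-of-u)) (S.resp (sym (proj₂ (proj₂ period-of-u))) S.ε∈)
    e : ℕ
    e = proj₁ minimal-power
    0<e : 0 ℕ.< e
    0<e = proj₁ (proj₂ minimal-power)
    u^e∈S : S (u ^ e)
    u^e∈S = proj₁ (proj₂ (proj₂ minimal-power))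
    u^i∉S : ∀ {i} → 0 ℕ.< i → i ℕ.< e → ¬ S (u ^ i)
    u^i∉S = proj₂ (proj₂ (proj₂ minimal-power))
    open CyclicExtension S-sub K-sub Kₒ S⊆K u∈K S▷u
    e∣p : e ∣ p
    e∣p = *-cancelʳ-∣ s (lagrange ·⟨⟩-isSubgroup K-sub ·⟨⟩⊆ (·⟨⟩-order 0<e u^e∈S u^i∉S Sₒ) Kₒ)
    by-index : e ≡ 1 ⊎ e ≡ p → S (u ^ p) × (∀ {i} → 0 ℕ.< i → i ℕ.< p → ¬ S (u ^ i))
    by-index (inj₁ e≡1) =
      contradiction (S.resp (Mult.×-homo-1 u) (≡.subst (S ∘ (u ^_)) e≡1 u^e∈S)) u∉S
    by-index (inj₂ e≡p) = ≡.subst (S ∘ (u ^_)) e≡p u^e∈S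
                        , λ 0<i i<p → u^i∉S 0<i (≡.subst (_ ℕ.<_) (≡.sym e≡p) i<p)

  module _ (M-sub : IsSubgroup M) (G-sub : IsSubgroup G) (M⊆G : M ⊆ G)
           (G▷a : NormalisedBy G a) (M▷a : NormalisedBy M a) (M▷a⁻¹ : NormalisedBy M (a ⁻¹)) where
    private
      module M = IsSubgroup M-sub
      module G = IsSubgroup G-sub

    conj-^-reflects : ∀ i → M (conj (a ^ i) x) → M x
    conj-^-reflects         zero    x∈ = M.resp (ε-conj _) x∈
    conj-^-reflects {x = x} (suc i) x∈ = conj-^-reflects i
      (M.resp (conj-inverse a _) (M▷a⁻¹ (M.resp (conj-comp a (a ^ i) x) x∈)))

    -- The exponents i for which a ^ i fixes the coset M h are closed under + and ∸. If a moved
    -- M h, then 1, h, conj a h, …, conj (a ^ (p ∸ 1)) h would lie in p + 1 distinct cosets of M.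
    centralises-quotient-of-prime-index : ∀ {p} → Prime p → HasOrder M s → HasOrder G (p * s) →
                                          a ^ p ≈ ε → ∀ {h} → G h → M ⁅ a , h ⁆
    centralises-quotient-of-prime-index {s = s} {p} p-prime Mₒ Gₒ a^p≈ε {h} h∈
      with HasOrder.decidable Mₒ M.resp ⁅ a , h ⁆
    ... | yes fixed = fixed
    ... | no moved  = contradiction (proj₂ (proj₂ (proj₂ collision)))
                                    (distinct (proj₁ (proj₂ (proj₂ collision))))
      where
      instance
        _ : NonZero s
        _ = order-nonZero M-sub Mₒ
      Fixes : Pred ℕ _
      Fixes i = M ⁅ a ^ i , h ⁆
      conj-^-+ : ∀ i j → conj (a ^ (i + j)) h ≈ conj (a ^ i) (conj (a ^ j) h)
      conj-^-+ i j = trans (conj-congˡ h (Mult.×-homo-+ a i j)) (conj-comp (a ^ i) (a ^ j) h)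
      cocycle : ∀ i j → conj (a ^ i) ⁅ a ^ j , h ⁆ ∙ ⁅ a ^ i , h ⁆ ≈ ⁅ a ^ (i + j) , h ⁆
      cocycle i j = begin
        conj (a ^ i) (conj (a ^ j) h // h) ∙ (conj (a ^ i) h // h)
          ≈⟨ ∙-congʳ (conj-// (a ^ i) _ h) ⟩
        (conj (a ^ i) (conj (a ^ j) h) // conj (a ^ i) h) ∙ (conj (a ^ i) h // h)
          ≈⟨ //-cancel _ (conj (a ^ i) h) h ⟩
        conj (a ^ i) (conj (a ^ j) h) // h
          ≈⟨ ∙-congʳ (conj-^-+ i j) ⟨
        conj (a ^ (i + j)) h // h ∎
      +-closed : ∀ {i j} → Fixes i → Fixes j → Fixes (i + j)
      +-closed {i} {j} Fi Fj = M.resp (cocycle i j) (M.∙∈ (normalisedBy-^ M.resp M▷a i Fj) Fi)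
      ∸-closed : ∀ {i j} → Fixes i → Fixes (i + j) → Fixes j
      ∸-closed {i} {j} Fi Fij =
        conj-^-reflects i (M.resp (sym (x≈z//y _ _ _ (cocycle i j))) (M.//∈ Fij Fi))
      Fixes-p : Fixes p
      Fixes-p = M.resp (sym (trans (∙-congʳ (trans (conj-congˡ h a^p≈ε) (ε-conj h))) (inverseʳ h)))
                       M.ε∈
      ¬Fixes-1 : ¬ Fixes 1
      ¬Fixes-1 = moved ∘ M.resp (∙-congʳ (conj-congˡ h (Mult.×-homo-1 a)))
      ¬Fixes : ∀ {i} → 0 ℕ.< i → i ℕ.< p → ¬ Fixes i
      ¬Fixes = prime-period-is-least p-prime (λ i → HasOrder.decidable Mₒ M.resp ⁅ a ^ i , h ⁆)
                 (λ {i} {j} → +-closed {i} {j}) (λ {i} {j} → ∸-closed {i} {j}) Fixes-p ¬Fixes-1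
      orbit : Fin (suc p) → Carrier
      orbit zero    = ε
      orbit (suc i) = conj (a ^ toℕ i) h
      orbit∈ : ∀ i → G (orbit i)
      orbit∈ zero    = G.ε∈
      orbit∈ (suc i) = normalisedBy-^ G.resp G▷a (toℕ i) h∈
      shift : ∀ i d → conj (a ^ i) h // conj (a ^ (i + d)) h ≈ conj (a ^ i) (h // conj (a ^ d) h)
      shift i d = trans (∙-congˡ (⁻¹-cong (conj-^-+ i d))) (sym (conj-// (a ^ i) h _))
      distinct : ∀ {i j} → i Fin.< j → ¬ M (orbit i // orbit j)
      distinct {zero} {suc j} _ ε//x∈ = moved (M.//∈ (M▷a h∈M) h∈M)
        where
        h∈M : M h
        h∈M = conj-^-reflects (toℕ j)
          (M.resp (trans (⁻¹-cong (identityˡ _)) (⁻¹-involutive _)) (M.⁻¹∈ ε//x∈))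
      distinct {suc i} {suc j} (s≤s i<j) x//y∈ =
        ¬Fixes (ℕ.m<n⇒0<n∸m i<j) (ℕ.≤-<-trans (ℕ.m∸n≤m (toℕ j) (toℕ i)) (Fin.toℕ<n j))
          (M.//-sym (conj-^-reflects (toℕ i) (M.resp (shift (toℕ i) _)
            (≡.subst (λ k → M (conj (a ^ toℕ i) h // conj (a ^ k) h))
              (≡.sym (ℕ.m+[n∸m]≡n (ℕ.<⇒≤ i<j))) x//y∈))))
      cosets : ∃[ q ] Transversal M G q
      cosets = transversal M-sub M⊆G Mₒ Gₒ
      #cosets≡p : proj₁ cosets ≡ p
      #cosets≡p = ℕ.*-cancelʳ-≡ _ p s
        (order-unique (transversal⇒order M-sub G-sub M⊆G (proj₂ cosets) Mₒ) Gₒ)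
      collision : ∃[ i ] ∃[ j ] (i Fin.< j × M (orbit i // orbit j))
      collision = cosets-pigeonhole M-sub (≡.subst (Transversal M G) #cosets≡p (proj₂ cosets))
                    orbit orbit∈

-- Permutation groups

open import Defs
open import Data.Fin.Permutation as Perm using (_⟨$⟩ʳ_; _⟨$⟩ˡ_; flip; _∘ₚ_)

-- Pointwise equality, wrapped in a record so that unification can recover both permutations.
infix 4 _≈ₚ_
record _≈ₚ_ {n} (π ρ : Perm n) : Set where
  constructor mk≈ₚ
  field pointwise : π Perm.≈ ρ
open _≈ₚ_

-- Opaque, as unfolding composition into the underlying bijections derails unification.
module _ {n : ℕ} where
  opaque
    infixl 7 _∙ₚ_
    infix  8 _⁻¹ₚ

    _∙ₚ_ : Perm n → Perm n → Perm n
    _∙ₚ_ = _∘ₚ_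

    _⁻¹ₚ : Perm n → Perm n
    _⁻¹ₚ = flip

    ∙ₚ≡∘ₚ : ∀ π ρ → π ∙ₚ ρ ≡ π ∘ₚ ρ
    ∙ₚ≡∘ₚ _ _ = ≡.refl

    ⁻¹ₚ≡flip : ∀ π → π ⁻¹ₚ ≡ flip π
    ⁻¹ₚ≡flip _ = ≡.refl

    ∙ₚ-isGroup : IsGroup _≈ₚ_ _∙ₚ_ Perm.id _⁻¹ₚ
    ∙ₚ-isGroup = record
      { isMonoid = record
        { isSemigroup = record
          { isMagma = record
            { isEquivalence = record
              { refl  = mk≈ₚ λ _ → ≡.refl
              ; sym   = λ π≈ρ → mk≈ₚ λ i → ≡.sym (pointwise π≈ρ i)
              ; trans = λ π≈ρ ρ≈σ → mk≈ₚ λ i → ≡.trans (pointwise π≈ρ i) (pointwise ρ≈σ i) }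
            ; ∙-cong = λ {π} {π′} {ρ} π≈π′ ρ≈ρ′ → mk≈ₚ λ i →
                ≡.trans (≡.cong (ρ ⟨$⟩ʳ_) (pointwise π≈π′ i)) (pointwise ρ≈ρ′ (π′ ⟨$⟩ʳ i)) }
          ; assoc = λ _ _ _ → mk≈ₚ λ _ → ≡.refl }
        ; identity = (λ _ → mk≈ₚ λ _ → ≡.refl) , (λ _ → mk≈ₚ λ _ → ≡.refl) }
      ; inverse = (λ π → mk≈ₚ λ _ → Perm.inverseʳ π) , (λ π → mk≈ₚ λ _ → Perm.inverseˡ π)
      ; ⁻¹-cong = λ {π} {ρ} π≈ρ → mk≈ₚ λ i → ≡.trans
          (≡.cong (π ⟨$⟩ˡ_) (≡.trans (≡.sym (Perm.inverseʳ ρ)) (≡.sym (pointwise π≈ρ (ρ ⟨$⟩ˡ i)))))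
          (Perm.inverseˡ π) }

  ∙ₚ-apply : ∀ π ρ i → (π ∙ₚ ρ) ⟨$⟩ʳ i ≡ ρ ⟨$⟩ʳ (π ⟨$⟩ʳ i)
  ∙ₚ-apply π ρ i = ≡.cong (λ σ → σ ⟨$⟩ʳ i) (∙ₚ≡∘ₚ π ρ)

  ⁻¹ₚ-apply : ∀ π i → π ⁻¹ₚ ⟨$⟩ʳ i ≡ π ⟨$⟩ˡ i
  ⁻¹ₚ-apply π i = ≡.cong (λ σ → σ ⟨$⟩ʳ i) (⁻¹ₚ≡flip π)

Sym : ℕ → Group 0ℓ 0ℓ
Sym n = record { isGroup = ∙ₚ-isGroup {n} }

_≟ₚ_ : ∀ {n} → Decidable₂ (_≈ₚ_ {n})
π ≟ₚ ρ = map′ mk≈ₚ pointwise (Fin.all? (λ i → π ⟨$⟩ʳ i Fin.≟ ρ ⟨$⟩ʳ i))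

module SymTheory (n : ℕ) = FiniteGroupTheory (Sym n) (_≟ₚ_ {n})

module _ {n : ℕ} where
  private
    module 𝕊 = SymTheory n
    module Sₙ = Group (Sym n)
    variable
      k : ℕ
      S : PermSet n

  open import Algebra.Properties.Group (Sym n) using (x∙y⁻¹≈ε⇒x≈y)

  Transitive : PermSet n → Set
  Transitive S = ∀ x y → ∃[ g ] (S g × g ⟨$⟩ʳ x ≡ y)

  Semiregular : PermSet n → Set
  Semiregular S = ∀ g x → S g → g ⟨$⟩ʳ x ≡ x → g ≈ₚ Perm.id

  fromIsSubgroup : IsSubgroup S → 𝕊.IsSubgroup S
  fromIsSubgroup {S = S} S-sub = record
    { resp = resp ∘ pointwise ; ε∈ = id∈
    ; ∙∈ = λ {g} {h} g∈ h∈ → ≡.subst S (≡.sym (∙ₚ≡∘ₚ g h)) (∘∈ g∈ h∈)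
    ; ⁻¹∈ = λ {g} g∈ → ≡.subst S (≡.sym (⁻¹ₚ≡flip g)) (inv∈ g∈) }
    where open IsSubgroup S-sub

  toIsSubgroup : 𝕊.IsSubgroup S → IsSubgroup S
  toIsSubgroup {S = S} S-sub = record
    { resp = resp ∘ mk≈ₚ ; id∈ = ε∈
    ; ∘∈ = λ {g} {h} g∈ h∈ → ≡.subst S (∙ₚ≡∘ₚ g h) (∙∈ g∈ h∈)
    ; inv∈ = λ {g} g∈ → ≡.subst S (⁻¹ₚ≡flip g) (⁻¹∈ g∈) }
    where open 𝕊.IsSubgroup S-sub

  fromHasOrder : HasOrder S k → 𝕊.HasOrder S k
  fromHasOrder Sₒ = record
    { enum = enum ; enum∈ = enum∈ ; enum-injective = inj _ _ ∘ pointwise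
    ; index = λ g∈ → proj₁ (surj _ g∈) ; enum-index = λ g∈ → mk≈ₚ (proj₂ (surj _ g∈)) }
    where open HasOrder Sₒ

  fromIsAbelian : IsAbelian S → ∀ {g h} → S g → S h → g ∙ₚ h ≈ₚ h ∙ₚ g
  fromIsAbelian S-abelian {g} {h} g∈ h∈ =
    mk≈ₚ (≡.subst₂ Perm._≈_ (≡.sym (∙ₚ≡∘ₚ g h)) (≡.sym (∙ₚ≡∘ₚ h g)) (S-abelian g h g∈ h∈))

  toCentralises : ∀ {T M : PermSet n} → (∀ {a m} → T a → M m → a ∙ₚ m ≈ₚ m ∙ₚ a) → Centralises T M
  toCentralises comm a m a∈ m∈ = ≡.subst₂ Perm._≈_ (∙ₚ≡∘ₚ a m) (∙ₚ≡∘ₚ m a) (pointwise (comm a∈ m∈))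

  fromNormalises : ∀ {T M : PermSet n} → Normalises T M → ∀ {a m} → T a → M m → M (a ⁻¹ₚ ∙ₚ (m ∙ₚ a))
  fromNormalises {M = M} T▷M {a} {m} a∈ m∈ =
    ≡.subst M (≡.sym (≡.trans (∙ₚ≡∘ₚ _ _) (≡.cong₂ _∘ₚ_ (⁻¹ₚ≡flip a) (∙ₚ≡∘ₚ m a)))) (T▷M a m a∈ m∈)

  stab-isSubgroup : ∀ {A : PermSet n} x → 𝕊.IsSubgroup A → 𝕊.IsSubgroup (Stab A x)
  stab-isSubgroup x A-sub = record
    { resp = λ g≈h (g∈ , gx≡x) → resp g≈h g∈ , ≡.trans (≡.sym (pointwise g≈h x)) gx≡x
    ; ε∈   = ε∈ , ≡.refl
    ; ∙∈   = λ {g} {h} (g∈ , gx≡x) (h∈ , hx≡x) → ∙∈ g∈ h∈ ,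
               ≡.trans (∙ₚ-apply g h x) (≡.trans (≡.cong (h ⟨$⟩ʳ_) gx≡x) hx≡x)
    ; ⁻¹∈  = λ {g} (g∈ , gx≡x) → ⁻¹∈ g∈ ,
               ≡.trans (⁻¹ₚ-apply g x) (≡.trans (≡.cong (g ⟨$⟩ˡ_) (≡.sym gx≡x)) (Perm.inverseˡ g)) }
    where open 𝕊.IsSubgroup A-sub

  stab? : ∀ {A : PermSet n} x → Decidable A → Decidable (Stab A x)
  stab? x A? g = A? g ×-dec (g ⟨$⟩ʳ x Fin.≟ x)

  //ₚ-fixes : ∀ (π ρ : Perm n) {x} → π ⟨$⟩ʳ x ≡ ρ ⟨$⟩ʳ x → (π ∙ₚ ρ ⁻¹ₚ) ⟨$⟩ʳ x ≡ x
  //ₚ-fixes π ρ {x} eq = begin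
    (π ∙ₚ ρ ⁻¹ₚ) ⟨$⟩ʳ x       ≡⟨ ∙ₚ-apply π (ρ ⁻¹ₚ) x ⟩
    ρ ⁻¹ₚ ⟨$⟩ʳ (π ⟨$⟩ʳ x)     ≡⟨ ⁻¹ₚ-apply ρ _ ⟩
    ρ ⟨$⟩ˡ (π ⟨$⟩ʳ x)         ≡⟨ ≡.cong (ρ ⟨$⟩ˡ_) eq ⟩
    ρ ⟨$⟩ˡ (ρ ⟨$⟩ʳ x)         ≡⟨ Perm.inverseˡ ρ ⟩
    x                         ∎
    where open ≡-Reasoning

  module _ (S-sub : 𝕊.IsSubgroup S) (S-semiregular : Semiregular S) (Sₒ : 𝕊.HasOrder S k) where
    open 𝕊.HasOrder Sₒ

    orbit-injective : ∀ x {i j} → enum i ⟨$⟩ʳ x ≡ enum j ⟨$⟩ʳ x → i ≡ j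
    orbit-injective x {i} {j} eq = enum-injective (x∙y⁻¹≈ε⇒x≈y (enum i) (enum j)
      (S-semiregular _ x (𝕊.IsSubgroup.//∈ S-sub (enum∈ i) (enum∈ j))
        (//ₚ-fixes (enum i) (enum j) eq)))

    regular⇒order≡degree : Transitive S → Fin n → k ≡ n
    regular⇒order≡degree S-transitive x = Fin.cantor-schröder-bernstein
      {f = λ i → enum i ⟨$⟩ʳ x} {g = index ∘ carrier} (orbit-injective x) carrier-injective
      where
      carrier : ∀ y → S (proj₁ (S-transitive x y))
      carrier y = proj₁ (proj₂ (S-transitive x y))
      carrier-injective : ∀ {y y′} → index (carrier y) ≡ index (carrier y′) → y ≡ y′
      carrier-injective {y} {y′} eq = ≡.trans (≡.sym (proj₂ (proj₂ (S-transitive x y))))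
        (≡.trans (pointwise (index-injective _ _ eq) x) (proj₂ (proj₂ (S-transitive x y′))))

    semiregular⇒transitive : k ≡ n → Transitive S
    semiregular⇒transitive ≡.refl x y with injective⇒surjective (orbit-injective x) ℕ.≤-refl y
    ... | i , eq = enum i , enum∈ i , eq

  fixed-by-∙ₚ : ∀ (π ρ : Perm n) {x} → (π ∙ₚ ρ) ⟨$⟩ʳ x ≡ x → ρ ⟨$⟩ʳ x ≡ x → π ⟨$⟩ʳ x ≡ x
  fixed-by-∙ₚ π ρ {x} πρx≡x ρx≡x = begin
    π ⟨$⟩ʳ x                    ≡⟨ Perm.inverseˡ ρ ⟨
    ρ ⟨$⟩ˡ (ρ ⟨$⟩ʳ (π ⟨$⟩ʳ x))  ≡⟨ ≡.cong (ρ ⟨$⟩ˡ_) (∙ₚ-apply π ρ x) ⟨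
    ρ ⟨$⟩ˡ ((π ∙ₚ ρ) ⟨$⟩ʳ x)    ≡⟨ ≡.cong (ρ ⟨$⟩ˡ_) (≡.trans πρx≡x (≡.sym ρx≡x)) ⟩
    ρ ⟨$⟩ˡ (ρ ⟨$⟩ʳ x)           ≡⟨ Perm.inverseˡ ρ ⟩
    x                           ∎
    where open ≡-Reasoning

  conj-fixes : ∀ (w r : Perm n) {x y} → w ⟨$⟩ʳ x ≡ y → r ⟨$⟩ʳ y ≡ y → 𝕊.conj w r ⟨$⟩ʳ x ≡ x
  conj-fixes w r {x} {y} wx≡y ry≡y = begin
    (w ∙ₚ r ∙ₚ w ⁻¹ₚ) ⟨$⟩ʳ x       ≡⟨ ∙ₚ-apply (w ∙ₚ r) (w ⁻¹ₚ) x ⟩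
    w ⁻¹ₚ ⟨$⟩ʳ ((w ∙ₚ r) ⟨$⟩ʳ x)   ≡⟨ ⁻¹ₚ-apply w _ ⟩
    w ⟨$⟩ˡ ((w ∙ₚ r) ⟨$⟩ʳ x)        ≡⟨ ≡.cong (w ⟨$⟩ˡ_) (∙ₚ-apply w r x) ⟩
    w ⟨$⟩ˡ (r ⟨$⟩ʳ (w ⟨$⟩ʳ x))      ≡⟨ ≡.cong (λ z → w ⟨$⟩ˡ (r ⟨$⟩ʳ z)) wx≡y ⟩
    w ⟨$⟩ˡ (r ⟨$⟩ʳ y)               ≡⟨ ≡.cong (w ⟨$⟩ˡ_) ry≡y ⟩
    w ⟨$⟩ˡ y                        ≡⟨ ≡.cong (w ⟨$⟩ˡ_) wx≡y ⟨
    w ⟨$⟩ˡ (w ⟨$⟩ʳ x)               ≡⟨ Perm.inverseˡ w ⟩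
    x                               ∎
    where open ≡-Reasoning

  trivial-stabiliser⇒semiregular : ∀ {G R : PermSet n} {x} → 𝕊.IsSubgroup R → Transitive G →
    (∀ {w} → G w → 𝕊.NormalisedBy R w) → (∀ {r} → R r → r ⟨$⟩ʳ x ≡ x → r ≈ₚ Perm.id) →
    Semiregular R
  trivial-stabiliser⇒semiregular {x = x} R-sub G-transitive G▷R Rₓ-trivial r y r∈ ry≡y
    with G-transitive x y
  ... | w , w∈ , wx≡y = begin
    r                             ≈⟨ 𝕊.conj-inverse w r ⟨
    𝕊.conj (w ⁻¹ₚ) (𝕊.conj w r)   ≈⟨ 𝕊.conj-cong (w ⁻¹ₚ) conj-w-r≈id ⟩
    𝕊.conj (w ⁻¹ₚ) Perm.id        ≈⟨ 𝕊.conj-ε (w ⁻¹ₚ) ⟩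
    Perm.id                       ∎
    where
    open ≈-Reasoning Sₙ.setoid
    conj-w-r≈id : 𝕊.conj w r ≈ₚ Perm.id
    conj-w-r≈id = Rₓ-trivial (G▷R w∈ r∈) (conj-fixes w r wx≡y ry≡y)


-- A regular nonabelian subgroup

module Construction
  {p} (p-prime : Prime p) {n} {A G M : PermSet n}
  (A-sub : IsSubgroup A) (G-sub : IsSubgroup G) (G⊆A : G ⊆ A) (G-index : HasIndex G A p)
  (G-regular : IsRegular G) (G-abelian : IsAbelian G)
  (M-sub : IsSubgroup M) (M⊆G : M ⊆ G) (M-index : HasIndex M G p)
  (x : Fin n) (Aₓ▷M : Normalises (Stab A x) M) (Aₓ⋫M : ¬ Centralises (Stab A x) M) where

  private
    module 𝕊 = SymTheory n
  open 𝕊 hiding (IsSubgroup; HasOrder)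
  open Group (Sym n)
  open import Algebra.Properties.Group (Sym n)
    using (⁻¹-involutive; ∙-cancelʳ; \\-leftDividesʳ; //-rightDividesˡ; inverseʳ-unique)
  open ≈-Reasoning setoid

  private
    A≤ : 𝕊.IsSubgroup A
    A≤ = fromIsSubgroup A-sub
    G≤ : 𝕊.IsSubgroup G
    G≤ = fromIsSubgroup G-sub
    M≤ : 𝕊.IsSubgroup M
    M≤ = fromIsSubgroup M-sub
    Aₓ≤ : 𝕊.IsSubgroup (Stab A x)
    Aₓ≤ = stab-isSubgroup x A≤
    module A = 𝕊.IsSubgroup A≤
    module G = 𝕊.IsSubgroup G≤
    module M = 𝕊.IsSubgroup M≤
    module Aₓ = 𝕊.IsSubgroup Aₓ≤

    #G #M : ℕ
    #G = proj₁ G-index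
    #M = proj₁ M-index
    G-order : 𝕊.HasOrder G #G
    G-order = fromHasOrder (proj₁ (proj₂ G-index))
    A-order : 𝕊.HasOrder A (p * #G)
    A-order = fromHasOrder (proj₂ (proj₂ G-index))
    M-order : 𝕊.HasOrder M #M
    M-order = fromHasOrder (proj₁ (proj₂ M-index))
    G-order′ : 𝕊.HasOrder G (p * #M)
    G-order′ = fromHasOrder (proj₂ (proj₂ M-index))

    M? : Decidable M
    M? = 𝕊.HasOrder.decidable M-order M.resp
    A? : Decidable A
    A? = 𝕊.HasOrder.decidable A-order A.resp
    M→G : ∀ {g} → M g → G g
    M→G = M⊆G _
    G→A : ∀ {g} → G g → A g
    G→A = G⊆A _
    G-comm : ∀ {g h} → G g → G h → g ∙ h ≈ h ∙ g
    G-comm = fromIsAbelian G-abelian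

  Gₓ-trivial : ∀ {u} → G u → u ⟨$⟩ʳ x ≡ x → u ≈ ε
  Gₓ-trivial u∈ ux≡x = mk≈ₚ (proj₂ G-regular _ x u∈ ux≡x)

  M-normalisedBy-Aₓ : ∀ {b} → Stab A x b → NormalisedBy M b
  M-normalisedBy-Aₓ {b} b∈ {m} m∈ = M.resp b⁻¹⁻¹∙m∙b⁻¹≈conj (fromNormalises Aₓ▷M (Aₓ.⁻¹∈ b∈) m∈)
    where
    b⁻¹⁻¹∙m∙b⁻¹≈conj : b ⁻¹ ⁻¹ ∙ (m ∙ b ⁻¹) ≈ conj b m
    b⁻¹⁻¹∙m∙b⁻¹≈conj = begin
      b ⁻¹ ⁻¹ ∙ (m ∙ b ⁻¹)   ≈⟨ assoc (b ⁻¹ ⁻¹) m (b ⁻¹) ⟨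
      b ⁻¹ ⁻¹ ∙ m ∙ b ⁻¹     ≈⟨ ∙-congʳ (∙-congʳ (⁻¹-involutive b)) ⟩
      b ∙ m ∙ b ⁻¹           ∎

  -- Opaque, so that the searches producing the witnesses are never unfolded.
  opaque
    noncommuting : ∃[ a ] ∃[ m₀ ] (Stab A x a × M m₀ × ¬ a ∙ m₀ ≈ m₀ ∙ a)
    noncommuting = noncommuting-pair
      (proj₂ (suborder A-order Aₓ.resp proj₁ (stab? x A?))) M-order
      (Aₓ⋫M ∘ toCentralises)

  a m₀ : Perm n
  a = proj₁ noncommuting
  m₀ = proj₁ (proj₂ noncommuting)

  a∈Aₓ : Stab A x a
  a∈Aₓ = proj₁ (proj₂ (proj₂ noncommuting))

  m₀∈M : M m₀
  m₀∈M = proj₁ (proj₂ (proj₂ (proj₂ noncommuting)))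

  a∙m₀≉m₀∙a : ¬ a ∙ m₀ ≈ m₀ ∙ a
  a∙m₀≉m₀∙a = proj₂ (proj₂ (proj₂ (proj₂ noncommuting)))

  G⊆Cᴬ[M] : ∀ {g} → G g → Centraliser A M g
  G⊆Cᴬ[M] g∈ = G→A g∈ , λ m∈ → G-comm g∈ (M→G m∈)

  Cᴬ[M]⊆G : ∀ {g} → Centraliser A M g → G g
  Cᴬ[M]⊆G = by-maximality (prime-index-maximal p-prime G≤ (centraliser-isSubgroup A≤) A≤
    G⊆Cᴬ[M] proj₁ (centraliser? A≤ A? M.resp M-order) G-order A-order)
    where
    by-maximality : (∀ {g} → Centraliser A M g → G g) ⊎ (∀ {g} → A g → Centraliser A M g) →
                    ∀ {g} → Centraliser A M g → G g
    by-maximality (inj₁ C⊆G) = C⊆G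
    by-maximality (inj₂ A⊆C) = contradiction (proj₂ (A⊆C (proj₁ a∈Aₓ)) m₀∈M) a∙m₀≉m₀∙a

  G-normalisedBy-Aₓ : ∀ {b} → Stab A x b → NormalisedBy G b
  G-normalisedBy-Aₓ b∈ h∈ = Cᴬ[M]⊆G (centraliser-normalisedBy A≤ (proj₁ b∈)
    (M-normalisedBy-Aₓ (Aₓ.⁻¹∈ b∈)) (G⊆Cᴬ[M] h∈))

  a∉G : ¬ G a
  a∉G a∈G = a∙m₀≉m₀∙a (begin
    a ∙ m₀   ≈⟨ ∙-congʳ a≈ε ⟩
    ε ∙ m₀   ≈⟨ identityˡ m₀ ⟩
    m₀       ≈⟨ identityʳ m₀ ⟨
    m₀ ∙ ε   ≈⟨ ∙-congˡ a≈ε ⟨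
    m₀ ∙ a   ∎)
    where
    a≈ε : a ≈ ε
    a≈ε = Gₓ-trivial a∈G (proj₂ a∈Aₓ)

  private
    a-powers : G (a ^ p) × (∀ {i} → 0 ℕ.< i → i ℕ.< p → ¬ G (a ^ i))
    a-powers = prime-index-power p-prime G≤ A≤ G→A G-order A-order (proj₁ a∈Aₓ)
                 (G-normalisedBy-Aₓ a∈Aₓ) a∉G

  a^p≈ε : a ^ p ≈ ε
  a^p≈ε = Gₓ-trivial (proj₁ a-powers) (proj₂ (Aₓ.^∈ a∈Aₓ p))

  a^i∉G : ∀ {i} → 0 ℕ.< i → i ℕ.< p → ¬ G (a ^ i)
  a^i∉G = proj₂ a-powers

  opaque
    g-witness : ∃[ g ] (G g × ¬ M g)
    g-witness = larger⇒∃∉ M.resp M? M-order G-order′ (≡.subst (#M ℕ.<_) (ℕ.*-comm #M p)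
      (ℕ.m<m*n #M p {{order-nonZero M≤ M-order}} (ℕ.nonTrivial⇒n>1 p {{prime⇒nonTrivial p-prime}})))

  g : Perm n
  g = proj₁ g-witness

  g∈G : G g
  g∈G = proj₁ (proj₂ g-witness)

  g∉M : ¬ M g
  g∉M = proj₂ (proj₂ g-witness)

  M-normalisedBy-G : ∀ {w} → G w → NormalisedBy M w
  M-normalisedBy-G w∈ m∈ = M.resp (sym (comm⇒conj≈ (G-comm w∈ (M→G m∈)))) m∈

  private
    g-powers : M (g ^ p) × (∀ {i} → 0 ℕ.< i → i ℕ.< p → ¬ M (g ^ i))
    g-powers = prime-index-power p-prime M≤ G≤ M→G M-order G-order′ g∈G (M-normalisedBy-G g∈G) g∉M

  g^i∉M : ∀ {i} → 0 ℕ.< i → i ℕ.< p → ¬ M (g ^ i)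
  g^i∉M = proj₂ g-powers

  a-centralises-G/M : ∀ {h} → G h → M ⁅ a , h ⁆
  a-centralises-G/M = centralises-quotient-of-prime-index M≤ G≤ M→G (G-normalisedBy-Aₓ a∈Aₓ)
    (M-normalisedBy-Aₓ a∈Aₓ) (M-normalisedBy-Aₓ (Aₓ.⁻¹∈ a∈Aₓ)) p-prime M-order G-order′ a^p≈ε

  t : Perm n
  t = a ∙ g

  t∈A : A t
  t∈A = A.∙∈ (proj₁ a∈Aₓ) (G→A g∈G)

  t-power : ∀ k → ∃[ h ] (G h × M (h // g ^ k) × t ^ k ≈ h ∙ a ^ k)
  t-power zero    = ε , G.ε∈ , M.//-refl , sym (identityˡ ε)
  t-power (suc k) with t-power k
  ... | h , h∈G , h≡gᵏ , tᵏ≈ = conj a (g ∙ h) , G-normalisedBy-Aₓ a∈Aₓ (G.∙∈ g∈G h∈G) ,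
    M.resp (//-cancel (conj a (g ∙ h)) (g ∙ h) (g ∙ g ^ k))
      (M.∙∈ (a-centralises-G/M (G.∙∈ g∈G h∈G))
            (M.resp (sym (∙-//-∙ g h (g ^ k))) (M-normalisedBy-G g∈G h≡gᵏ))) ,
    (begin
      t ∙ t ^ k               ≈⟨ ∙-congˡ tᵏ≈ ⟩
      (a ∙ g) ∙ (h ∙ a ^ k)   ≈⟨ ∙-∙-conj a g h (a ^ k) ⟩
      conj a (g ∙ h) ∙ (a ∙ a ^ k) ∎)

  t^p∈M : M (t ^ p)
  t^p∈M with t-power p
  ... | h , _ , h≡gᵖ , tᵖ≈ =
    M.resp (sym tᵖ≈h) (M.resp (//-rightDividesˡ (g ^ p) h) (M.∙∈ h≡gᵖ (proj₁ g-powers)))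
    where
    tᵖ≈h : t ^ p ≈ h
    tᵖ≈h = trans tᵖ≈ (trans (∙-congˡ a^p≈ε) (identityʳ h))

  t^i∉M : ∀ {i} → 0 ℕ.< i → i ℕ.< p → ¬ M (t ^ i)
  t^i∉M {i} 0<i i<p tⁱ∈M with t-power i
  ... | h , h∈G , _ , tⁱ≈ = a^i∉G 0<i i<p
    (G.resp (\\-leftDividesʳ h (a ^ i)) (G.∙∈ (G.⁻¹∈ h∈G) (G.resp tⁱ≈ (M→G tⁱ∈M))))

  M-normalisedBy-t : NormalisedBy M t
  M-normalisedBy-t m∈ =
    M.resp (sym (conj-comp a g _)) (M-normalisedBy-Aₓ a∈Aₓ (M-normalisedBy-G g∈G m∈))

  R : PermSet n
  R = M ·⟨ t ⟩

  open CyclicExtension M≤ A≤ A-order (G→A ∘ M→G) t∈A M-normalisedBy-t public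
    renaming (·⟨⟩-isSubgroup to R-isSubgroup; ·⟨⟩⊆ to R⊆A; ⊆·⟨⟩ to M⊆R)

  private
    module R = 𝕊.IsSubgroup R-isSubgroup
    0<p : 0 ℕ.< p
    0<p = ℕ.<-trans (s≤s z≤n) (ℕ.nonTrivial⇒n>1 p {{prime⇒nonTrivial p-prime}})

  R-order : 𝕊.HasOrder R (p * #M)
  R-order = ·⟨⟩-order 0<p t^p∈M t^i∉M M-order

  Rₓ-trivial : ∀ {r} → R r → r ⟨$⟩ʳ x ≡ x → r ≈ ε
  Rₓ-trivial {r} r∈ rx≡x = begin
    r                ≈⟨ r≈m′∙h∙aᶜ ⟩
    m′ ∙ h ∙ a ^ c   ≈⟨ ∙-cong m′∙h≈ε (reflexive (≡.cong (a ^_) c≡0)) ⟩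
    ε ∙ ε            ≈⟨ identityˡ ε ⟩
    ε                ∎
    where
    open Transversal (powers-transversal 0<p t^p∈M t^i∉M)
    c : ℕ
    c = toℕ (coset r∈)
    m′ h : Perm n
    m′ = r // t ^ c
    h = proj₁ (t-power c)
    h∈G : G h
    h∈G = proj₁ (proj₂ (t-power c))
    h≡gᶜ : M (h // g ^ c)
    h≡gᶜ = proj₁ (proj₂ (proj₂ (t-power c)))
    tᶜ≈ : t ^ c ≈ h ∙ a ^ c
    tᶜ≈ = proj₂ (proj₂ (proj₂ (t-power c)))
    r≈m′∙h∙aᶜ : r ≈ m′ ∙ h ∙ a ^ c
    r≈m′∙h∙aᶜ = begin
      r                 ≈⟨ //-rightDividesˡ (t ^ c) r ⟨
      m′ ∙ t ^ c        ≈⟨ ∙-congˡ tᶜ≈ ⟩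
      m′ ∙ (h ∙ a ^ c)  ≈⟨ assoc m′ h (a ^ c) ⟨
      m′ ∙ h ∙ a ^ c    ∎
    m′∙h≈ε : m′ ∙ h ≈ ε
    m′∙h≈ε = Gₓ-trivial (G.∙∈ (M→G (∈coset r∈)) h∈G) (fixed-by-∙ₚ (m′ ∙ h) (a ^ c)
      (≡.trans (≡.sym (pointwise r≈m′∙h∙aᶜ x)) rx≡x) (proj₂ (Aₓ.^∈ a∈Aₓ c)))
    gᶜ∈M : M (g ^ c)
    gᶜ∈M = M.resp (//-rightDividesˡ h (g ^ c)) (M.∙∈ (M.//-sym h≡gᶜ)
      (M.resp (sym (inverseʳ-unique m′ h m′∙h≈ε)) (M.⁻¹∈ (∈coset r∈))))
    c≡0 : c ≡ 0
    c≡0 = ℕ.n≤0⇒n≡0 (ℕ.≮⇒≥ λ 0<c → g^i∉M 0<c (Fin.toℕ<n (coset r∈)) gᶜ∈M)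

  R-normalisedBy-G : ∀ {w} → G w → NormalisedBy R w
  R-normalisedBy-G {w} w∈ {r} (m , i , m∈ , r≈) =
    R.resp (sym conj≈) (R.∙∈ (M⊆R (M-normalisedBy-G w∈ m∈)) (R.^∈ conj-t∈R i))
    where
    conj-t∈R : R (conj w t)
    conj-t∈R = ⁅ w , a ⁆ , 1 , M.resp (⁅⁆-⁻¹ a w) (M.⁻¹∈ (a-centralises-G/M w∈)) ,
      trans (conj-∙-commuting a (G-comm w∈ g∈G)) (∙-congˡ (sym (identityʳ t)))
    conj≈ : conj w r ≈ conj w m ∙ conj w t ^ i
    conj≈ = trans (conj-cong w r≈) (trans (conj-homo w m (t ^ i)) (∙-congˡ (conj-^ w t i)))

  R-semiregular : Semiregular R
  R-semiregular =
    trivial-stabiliser⇒semiregular R-isSubgroup (proj₁ G-regular) R-normalisedBy-G Rₓ-trivial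

  R-regular : IsRegular R
  R-regular = semiregular⇒transitive R-isSubgroup R-semiregular R-order |R|≡n
            , λ r y r∈ ry≡y → pointwise (R-semiregular r y r∈ ry≡y)
    where
    G-semiregular : Semiregular G
    G-semiregular g y g∈ gy≡y = mk≈ₚ (proj₂ G-regular g y g∈ gy≡y)
    |R|≡n : p * #M ≡ n
    |R|≡n = regular⇒order≡degree G≤ G-semiregular G-order′ (proj₁ G-regular) x

  R-nonabelian : ¬ IsAbelian R
  R-nonabelian R-abelian = a∙m₀≉m₀∙a (∙-cancelʳ g (a ∙ m₀) (m₀ ∙ a) (begin
    a ∙ m₀ ∙ g     ≈⟨ assoc a m₀ g ⟩
    a ∙ (m₀ ∙ g)   ≈⟨ ∙-congˡ (G-comm (M→G m₀∈M) g∈G) ⟩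
    a ∙ (g ∙ m₀)   ≈⟨ assoc a g m₀ ⟨
    t ∙ m₀         ≈⟨ fromIsAbelian R-abelian t∈R (M⊆R m₀∈M) ⟩
    m₀ ∙ t         ≈⟨ assoc m₀ a g ⟨
    m₀ ∙ a ∙ g     ∎))
    where
    t∈R : R t
    t∈R = ε , 1 , M.ε∈ , sym (trans (identityˡ _) (identityʳ t))

-- The p-group hypothesis is not needed: the two index-p conditions suffice.
lemma3p4 : (p : ℕ) → Prime p → (n : ℕ) → (A : PermSet n) → IsSubgroup A → IsPGroup p A →
    (G : PermSet n) → IsSubgroup G → G ⊆ A → HasIndex G A p → IsRegular G → IsAbelian G →
    (M : PermSet n) → IsSubgroup M → M ⊆ G → HasIndex M G p →
    (∃[ x ] (Normalises (Stab A x) M × ¬ Centralises (Stab A x) M)) →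
    ∃[ R ] (IsSubgroup R × R ⊆ A × IsRegular R × ¬ IsAbelian R)
lemma3p4 p p-prime n A A-sub _ G G-sub G⊆A G-index G-regular G-abelian M M-sub M⊆G M-index
         (x , Aₓ▷M , Aₓ⋫M) =
  R , toIsSubgroup R-isSubgroup , (λ _ → R⊆A) , R-regular , R-nonabelian
  where
  open Construction p-prime A-sub G-sub G⊆A G-index G-regular G-abelian M-sub M⊆G M-index x Aₓ▷M Aₓ⋫M
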